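{- For every $n\ge 1$, every word $w$ of length $n$ over an alphabet $\Sigma$ satisfies $SP(w)\le F_{n+2}-1$, where $F_k$ denotes the $k$-th Fibonacci number ($F_1=F_2=1$, $F_k=F_{k-1}+F_{k-2}$ for $k\ge 3$).
   Context: A word $u$ is a scattered subword of $w$ if $u$ is a (not necessarily contiguous) subsequence of $w$. A palindrome is a word equal to its reversal. $SP(w)$ denotes the number of distinct non-empty palindromes that are scattered subwords of $w$. -}

module Defs where

open import Data.Nat using (ℕ; zero; suc; _+_)
open import Data.List using (List; []; _∷_; _++_; map; reverse; filter; length; deduplicate)
open import Data.List.Properties using (≡-dec)
open import Data.Product using (_×_)
open import Relation.Binary.Definitions using (DecidableEquality)
open import Relation.Binary.PropositionalEquality using (_≡_; _≢_)
open import Relation.Nullary using (Dec; ¬?)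
open import Relation.Nullary.Decidable using (_×-dec_)

-- Fibonacci numbers: fib 0 = 0, fib 1 = 1, fib (k+2) = fib (k+1) + fib k,
-- so fib 1 = fib 2 = 1 as in the paper.
fib : ℕ → ℕ
fib zero = 0
fib (suc zero) = 1
fib (suc (suc k)) = fib (suc k) + fib k

module _ {A : Set} (_≟_ : DecidableEquality A) where

  -- all scattered subwords (subsequences) of w, listed with repetitions
  -- (one entry per choice of positions)
  subsequences : List A → List (List A)
  subsequences [] = [] ∷ []
  subsequences (x ∷ xs) = map (x ∷_) (subsequences xs) ++ subsequences xs

  NonEmptyPalindrome : List A → Set
  NonEmptyPalindrome u = (u ≢ []) × (u ≡ reverse u)

  nonEmptyPalindrome? : (u : List A) → Dec (NonEmptyPalindrome u)
  nonEmptyPalindrome? u = ¬? (≡-dec _≟_ u []) ×-dec ≡-dec _≟_ u (reverse u)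

  SP : List A → ℕ
  SP w = length (deduplicate (≡-dec _≟_) (filter nonEmptyPalindrome? (subsequences w)))

{-# OPTIONS --safe #-}
module Submission where

-- Split the palindromic subwords of a ∷ u according to whether they use the
-- leading a.  Those that do are [ a ] or a ∷ p ++ [ a ]; the closing a can be
-- matched with the last occurrence of a in u, so p is a (possibly empty)
-- palindromic subword of the part of u before that occurrence, a word of
-- length at most |u| − 1.  Hence SP (a ∷ u) ≤ SP u + 1 + SP (that prefix),
-- and SP (a ∷ u) ≤ SP u + 1 when a does not occur in u; by induction
-- SP w + 1 ≤ fib (|w| + 2).

open import Defs
open import Data.Nat using (ℕ; zero; suc; pred; _+_; _∸_; _≤_; _<_; z≤n; s≤s; s≤s⁻¹)
open import Data.Nat.Properties
  using (≤-trans; ≤-reflexive; +-comm; +-mono-≤; m≤m+n; suc[m]≤n⇒m≤pred[n]; pred[m∸n]≡m∸[1+n]; module ≤-Reasoning)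
open import Data.List using (List; []; _∷_; _++_; [_]; map; reverse; filter; length; deduplicate; initLast; _∷ʳ′_)
open import Data.List.Properties using (≡-dec; ∷-injective; ∷ʳ-injectiveˡ; reverse-++; unfold-reverse; length-++; length-map; length-removeAt′)
open import Data.List.Membership.Propositional using (_∈_; _∉_)
open import Data.List.Membership.Propositional.Properties
  using (∈-filter⁺; ∈-filter⁻; ∈-deduplicate⁺; ∈-deduplicate⁻; ∈-map⁺; ∈-map⁻; ∈-++⁺ˡ; ∈-++⁺ʳ; ∈-++⁻)
import Data.List.Membership.DecPropositional as DecMembership
open import Data.List.Relation.Unary.Any using (here; there; _─_)
import Data.List.Relation.Unary.All as All
import Data.List.Relation.Unary.AllPairs as AllPairs
open import Data.List.Relation.Unary.Unique.Propositional using (Unique)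
open import Data.List.Relation.Unary.Unique.DecPropositional.Properties using (deduplicate-!)
open import Data.List.Relation.Binary.Subset.Propositional using (_⊆_)
open import Data.List.Relation.Binary.Sublist.Propositional
  using ([]; _∷_; _∷ʳ_; minimum; from∈; lookup) renaming (_⊆_ to _⊑_)
open import Data.Product using (_×_; _,_; ∃-syntax)
open import Data.Sum using (_⊎_; inj₁; inj₂)
open import Relation.Nullary using (yes; no; contradiction)
open import Relation.Binary.Definitions using (DecidableEquality)
open import Relation.Binary.PropositionalEquality using (_≡_; _≢_; refl; sym; trans; cong)

0<fib[1+n] : ∀ n → 0 < fib (suc n)
0<fib[1+n] zero = s≤s z≤n
0<fib[1+n] (suc n) = ≤-trans (0<fib[1+n] n) (m≤m+n _ _)

module _ {A : Set} where

  ∈-─ : ∀ {x y} {ys : List A} (x∈ys : x ∈ ys) → y ∈ ys → y ≢ x → y ∈ (ys ─ x∈ys)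
  ∈-─ (here refl) (here refl) y≢x = contradiction refl y≢x
  ∈-─ (here refl) (there y∈ys) _ = y∈ys
  ∈-─ (there _) (here y≡z) _ = here y≡z
  ∈-─ (there x∈ys) (there y∈ys) y≢x = there (∈-─ x∈ys y∈ys y≢x)

  Unique-⊆⇒length-≤ : ∀ {xs ys : List A} → Unique xs → xs ⊆ ys → length xs ≤ length ys
  Unique-⊆⇒length-≤ AllPairs.[] _ = z≤n
  Unique-⊆⇒length-≤ {x ∷ xs} {ys} (x∉xs AllPairs.∷ xs!) xs⊆ys = begin
    suc (length xs)          ≤⟨ s≤s (Unique-⊆⇒length-≤ xs! xs⊆ys─x) ⟩
    suc (length (ys ─ x∈ys)) ≡⟨ sym (length-removeAt′ ys _) ⟩
    length ys                ∎
    where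
    open ≤-Reasoning
    x∈ys : x ∈ ys
    x∈ys = xs⊆ys (here refl)
    xs⊆ys─x : xs ⊆ (ys ─ x∈ys)
    xs⊆ys─x y∈xs = ∈-─ x∈ys (xs⊆ys (there y∈xs)) λ y≡x → All.lookup x∉xs y∈xs (sym y≡x)

  reverse-∷-++ : ∀ (a : A) p b → reverse (a ∷ p ++ [ b ]) ≡ b ∷ reverse p ++ [ a ]
  reverse-∷-++ a p b = trans (reverse-++ (a ∷ p) [ b ]) (cong (b ∷_) (unfold-reverse a p))

  palindrome-∷-view : ∀ {a : A} y → a ∷ y ≡ reverse (a ∷ y) →
                      y ≡ [] ⊎ ∃[ p ] (y ≡ p ++ [ a ] × p ≡ reverse p)
  palindrome-∷-view y pal with initLast y
  ... | [] = inj₁ refl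
  ... | p ∷ʳ′ b with ∷-injective (trans pal (reverse-∷-++ _ p b))
  ...   | refl , p∷ʳa≡rev = inj₂ (p , refl , ∷ʳ-injectiveˡ p (reverse p) p∷ʳa≡rev)

module _ {A : Set} (_≟_ : DecidableEquality A) where

  open DecMembership _≟_ using (_∈?_)

  ∈-subsequences⇒⊑ : ∀ {u} w → u ∈ subsequences _≟_ w → u ⊑ w
  ∈-subsequences⇒⊑ [] (here refl) = []
  ∈-subsequences⇒⊑ (x ∷ w) u∈ with ∈-++⁻ (map (x ∷_) (subsequences _≟_ w)) u∈
  ... | inj₁ u∈x∷ with ∈-map⁻ (x ∷_) u∈x∷
  ...   | _ , v∈ , refl = refl ∷ ∈-subsequences⇒⊑ w v∈
  ∈-subsequences⇒⊑ (x ∷ w) u∈ | inj₂ u∈′ = x ∷ʳ ∈-subsequences⇒⊑ w u∈′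

  ⊑⇒∈-subsequences : ∀ {u w} → u ⊑ w → u ∈ subsequences _≟_ w
  ⊑⇒∈-subsequences [] = here refl
  ⊑⇒∈-subsequences (_∷ʳ_ {ys = w} x τ) = ∈-++⁺ʳ (map (x ∷_) (subsequences _≟_ w)) (⊑⇒∈-subsequences τ)
  ⊑⇒∈-subsequences (refl ∷ τ) = ∈-++⁺ˡ (∈-map⁺ _ (⊑⇒∈-subsequences τ))

  palindromes : List A → List (List A)
  palindromes w = deduplicate (≡-dec _≟_) (filter (nonEmptyPalindrome? _≟_) (subsequences _≟_ w))

  palindromes-unique : ∀ w → Unique (palindromes w)
  palindromes-unique w = deduplicate-! (≡-dec _≟_) _

  ∈-palindromes⁻ : ∀ {x} w → x ∈ palindromes w → x ⊑ w × NonEmptyPalindrome _≟_ x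
  ∈-palindromes⁻ w x∈ with ∈-filter⁻ (nonEmptyPalindrome? _≟_) (∈-deduplicate⁻ (≡-dec _≟_) _ x∈)
  ... | x∈subs , nep = ∈-subsequences⇒⊑ w x∈subs , nep

  ∈-palindromes⁺ : ∀ {x w} → x ⊑ w → NonEmptyPalindrome _≟_ x → x ∈ palindromes w
  ∈-palindromes⁺ τ nep =
    ∈-deduplicate⁺ (≡-dec _≟_) (∈-filter⁺ (nonEmptyPalindrome? _≟_) (⊑⇒∈-subsequences τ) nep)

  ∈-palindromes-∷ : ∀ {x} a u → x ∈ palindromes (a ∷ u) →
                    x ∈ palindromes u ⊎ x ≡ [ a ] ⊎
                    ∃[ p ] (x ≡ a ∷ p ++ [ a ] × p ++ [ a ] ⊑ u × p ≡ reverse p)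
  ∈-palindromes-∷ a u x∈ with ∈-palindromes⁻ (a ∷ u) x∈
  ... | .a ∷ʳ τ , nep = inj₁ (∈-palindromes⁺ τ nep)
  ... | _∷_ {xs = y} refl τ , _ , pal with palindrome-∷-view y pal
  ...   | inj₁ refl = inj₂ (inj₁ refl)
  ...   | inj₂ (p , refl , p-pal) = inj₂ (inj₂ (p , refl , τ , p-pal))

  -- The prefix of u before the last occurrence of a (junk value [] if a ∉ u).
  beforeLast : A → List A → List A
  beforeLast a [] = []
  beforeLast a (x ∷ u) with a ∈? u
  ... | yes _ = x ∷ beforeLast a u
  ... | no  _ = []

  length-beforeLast : ∀ a b u → length (beforeLast a (b ∷ u)) ≤ length u
  length-beforeLast a b u with a ∈? u
  length-beforeLast a b (c ∷ u) | yes _ = s≤s (length-beforeLast a c u)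
  ... | no _ = z≤n

  ⊑-beforeLast : ∀ {a} p u → p ++ [ a ] ⊑ u → p ⊑ beforeLast a u
  ⊑-beforeLast [] u _ = minimum _
  ⊑-beforeLast {a} (z ∷ p) (x ∷ u) τ with a ∈? u
  ... | yes _ with τ
  ...   | .x ∷ʳ τ′ = x ∷ʳ ⊑-beforeLast (z ∷ p) u τ′
  ...   | refl ∷ τ′ = refl ∷ ⊑-beforeLast p u τ′
  ⊑-beforeLast (z ∷ p) (x ∷ u) τ | no a∉u with τ
  ...   | .x ∷ʳ τ′ = contradiction (lookup τ′ (∈-++⁺ʳ (z ∷ p) (here refl))) a∉u
  ...   | refl ∷ τ′ = contradiction (lookup τ′ (∈-++⁺ʳ p (here refl))) a∉u

  SP-∷-∉ : ∀ {a u} → a ∉ u → SP _≟_ (a ∷ u) ≤ suc (SP _≟_ u)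
  SP-∷-∉ {a} {u} a∉u = Unique-⊆⇒length-≤ (palindromes-unique (a ∷ u)) cover
    where
    cover : palindromes (a ∷ u) ⊆ [ a ] ∷ palindromes u
    cover x∈ with ∈-palindromes-∷ a u x∈
    ... | inj₁ x∈u = there x∈u
    ... | inj₂ (inj₁ refl) = here refl
    ... | inj₂ (inj₂ (p , refl , τ , _)) = contradiction (lookup τ (∈-++⁺ʳ p (here refl))) a∉u

  SP-∷-∈ : ∀ {a u} → a ∈ u → SP _≟_ (a ∷ u) ≤ SP _≟_ u + suc (SP _≟_ (beforeLast a u))
  SP-∷-∈ {a} {u} a∈u = begin
    SP _≟_ (a ∷ u)                                        ≤⟨ Unique-⊆⇒length-≤ (palindromes-unique (a ∷ u)) cover ⟩
    length (palindromes u ++ (a ∷ a ∷ []) ∷ map wrap ps)  ≡⟨ length-++ (palindromes u) ⟩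
    SP _≟_ u + suc (length (map wrap ps))                 ≡⟨ cong (λ k → SP _≟_ u + suc k) (length-map wrap ps) ⟩
    SP _≟_ u + suc (SP _≟_ (beforeLast a u))              ∎
    where
    open ≤-Reasoning
    ps : List (List A)
    ps = palindromes (beforeLast a u)
    wrap : List A → List A
    wrap p = a ∷ p ++ [ a ]
    cover : palindromes (a ∷ u) ⊆ palindromes u ++ (a ∷ a ∷ []) ∷ map wrap ps
    cover x∈ with ∈-palindromes-∷ a u x∈
    ... | inj₁ x∈u = ∈-++⁺ˡ x∈u
    ... | inj₂ (inj₁ refl) = ∈-++⁺ˡ (∈-palindromes⁺ (from∈ a∈u) ((λ ()) , refl))
    ... | inj₂ (inj₂ ([] , refl , _)) = ∈-++⁺ʳ (palindromes u) (here refl)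
    ... | inj₂ (inj₂ (p@(_ ∷ _) , refl , τ , p-pal)) =
      ∈-++⁺ʳ (palindromes u) (there (∈-map⁺ wrap (∈-palindromes⁺ (⊑-beforeLast p u τ) ((λ ()) , p-pal))))

  SP<fib : ∀ n w → length w ≤ n → SP _≟_ w < fib (2 + n)
  SP<fib n [] _ = 0<fib[1+n] (suc n)
  SP<fib (suc m) (a ∷ u) (s≤s |u|≤m) with a ∈? u
  ... | no a∉u = begin
    suc (SP _≟_ (a ∷ u))      ≤⟨ s≤s (SP-∷-∉ a∉u) ⟩
    suc (suc (SP _≟_ u))      ≡⟨ cong suc (+-comm 1 (SP _≟_ u)) ⟩
    suc (SP _≟_ u) + 1        ≤⟨ +-mono-≤ (SP<fib m u |u|≤m) (0<fib[1+n] m) ⟩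
    fib (2 + m) + fib (1 + m) ∎
    where open ≤-Reasoning
  SP<fib (suc (suc k)) (a ∷ b ∷ u) (s≤s |bu|≤1+k) | yes a∈bu = begin
    suc (SP _≟_ (a ∷ b ∷ u))              ≤⟨ s≤s (SP-∷-∈ a∈bu) ⟩
    suc (SP _≟_ (b ∷ u)) + suc (SP _≟_ c) ≤⟨ +-mono-≤ (SP<fib (suc k) (b ∷ u) |bu|≤1+k) (SP<fib k c |c|≤k) ⟩
    fib (3 + k) + fib (2 + k)             ∎
    where
    open ≤-Reasoning
    c : List A
    c = beforeLast a (b ∷ u)
    |c|≤k : length c ≤ k
    |c|≤k = ≤-trans (length-beforeLast a b u) (s≤s⁻¹ |bu|≤1+k)

-- The bound also holds for n = 0.
theorem4p2 : {Σ : Set} (_≟_ : DecidableEquality Σ) (n : ℕ) → 1 ≤ n →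
    (w : List Σ) → length w ≡ n → SP _≟_ w ≤ fib (n + 2) ∸ 1
theorem4p2 _≟_ n _ w |w|≡n = begin
  SP _≟_ w           ≤⟨ suc[m]≤n⇒m≤pred[n] (SP<fib _≟_ n w (≤-reflexive |w|≡n)) ⟩
  pred (fib (2 + n)) ≡⟨ pred[m∸n]≡m∸[1+n] (fib (2 + n)) 0 ⟩
  fib (2 + n) ∸ 1    ≡⟨ cong (λ k → fib k ∸ 1) (+-comm 2 n) ⟩
  fib (n + 2) ∸ 1    ∎
  where open ≤-Reasoning
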